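{- Assume $|A|\ge 2$. Let $s$ and $t$ be (possibly open) terms over $\Sigma_{CP}(A)$ such that for every closed substitution $\sigma$ (mapping every variable to a closed term) we have $\mathrm{CP}\vdash \sigma(s)=\sigma(t)$. Then $\mathrm{CP}\vdash s=t$. (That is, CP is $\omega$-complete.)
   Context: Fix a finite non-empty set $A$ of atomic propositions and an infinite set $V$ of variables. Terms over the signature $\Sigma_{CP}(A)$ are built from the constants $T$, $F$, the atomic propositions $a\in A$ and the variables by the ternary operator of conditional composition $t\triangleleft r\triangleright s$ (read "if $r$ then $t$ else $s$"). Closed terms are terms without variables. CP is the equational theory with axioms (CP1) $x\triangleleft T\triangleright y=x$, (CP2) $x\triangleleft F\triangleright y=y$, (CP3) $T\triangleleft x\triangleright F=x$, (CP4) $x\triangleleft(y\triangleleft z\triangleright u)\triangleright v=(x\triangleleft y\triangleright v)\triangleleft z\triangleright(x\triangleleft u\triangleright v)$; $\mathrm{CP}\vdash s=t$ means derivability in equational logic (reflexivity, symmetry, transitivity, substitution, congruence). -}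

module Defs where

open import Data.Nat using (ℕ)
open import Data.Fin using (Fin)
open import Data.Empty using (⊥)

-- Atomic propositions: A = Fin n (any finite set is in bijection with some Fin n).
-- Variables: V = ℕ (a countably infinite set); more generally terms over a variable type X.

infix 5 _◁_▷_

data Term (n : ℕ) (X : Set) : Set where
  T F : Term n X
  atom : Fin n → Term n X
  var  : X → Term n X
  _◁_▷_ : Term n X → Term n X → Term n X → Term n X   -- t ◁ r ▷ s = "if r then t else s"

OTerm : ℕ → Set
OTerm n = Term n ℕ

CTerm : ℕ → Set
CTerm n = Term n ⊥

subst : ∀ {n X Y} → (X → Term n Y) → Term n X → Term n Y
subst σ T = T
subst σ F = F
subst σ (atom a) = atom a
subst σ (var x) = σ x
subst σ (t ◁ r ▷ s) = subst σ t ◁ subst σ r ▷ subst σ s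

-- Equational logic derivability from the CP axioms (instances via substitution
-- are built into the axiom rules, congruence for the ternary operator,
-- reflexivity, symmetry, transitivity).
infix 4 CP⊢_≈_
data CP⊢_≈_ {n : ℕ} {X : Set} : Term n X → Term n X → Set where
  cp1 : ∀ x y → CP⊢ (x ◁ T ▷ y) ≈ x
  cp2 : ∀ x y → CP⊢ (x ◁ F ▷ y) ≈ y
  cp3 : ∀ x → CP⊢ (T ◁ x ▷ F) ≈ x
  cp4 : ∀ x y z u v →
        CP⊢ (x ◁ (y ◁ z ▷ u) ▷ v) ≈ ((x ◁ y ▷ v) ◁ z ▷ (x ◁ u ▷ v))
  refl  : ∀ {t} → CP⊢ t ≈ t
  sym   : ∀ {s t} → CP⊢ s ≈ t → CP⊢ t ≈ s
  trans : ∀ {s t u} → CP⊢ s ≈ t → CP⊢ t ≈ u → CP⊢ s ≈ u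
  cong  : ∀ {t t' r r' s s'} → CP⊢ t ≈ t' → CP⊢ r ≈ r' → CP⊢ s ≈ s' →
          CP⊢ (t ◁ r ▷ s) ≈ (t' ◁ r' ▷ s')

-- CP proves s = t exactly when s and t have the same decision tree (basic form): the axioms
-- are the laws of grafting trees onto the leaves of a tree, and every term is provably equal
-- to the term read back from its tree.  A substitution mapping variables to atoms acts on
-- trees by relabelling, and with two atoms available a suitable such substitution separates
-- any two distinct labels.  So trees that agree under every atom substitution are equal.
module Submission where

open import Defs
open import Data.Nat as ℕ using (ℕ; _≥_; suc; s≤s)
open import Data.Fin using (Fin; zero) renaming (suc to fsuc)
open import Data.Bool using (Bool; true; false; if_then_else_)
open import Data.Product using (_×_; _,_; proj₁; proj₂)
open import Data.Sum using (_⊎_; inj₁; inj₂; [_,_]′)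
open import Data.Sum.Properties using (inj₁-injective)
open import Data.Empty using (⊥)
open import Function using (_∘_; const)
open import Relation.Nullary using (yes; no; does; contradiction)
open import Relation.Binary.Definitions using (DecidableEquality)
open import Relation.Binary.PropositionalEquality as ≡ using (_≡_; _≢_)

data Tree (L : Set) : Set where
  leaf : Bool → Tree L
  node : L → Tree L → Tree L → Tree L

node-injective : ∀ {L} {a b : L} {p q s t : Tree L} →
                 node a p q ≡ node b s t → a ≡ b × p ≡ s × q ≡ t
node-injective ≡.refl = ≡.refl , ≡.refl , ≡.refl

graft : ∀ {L} → Tree L → Tree L → Tree L → Tree L
graft (leaf true)  l r = l
graft (leaf false) l r = r
graft (node c p q) l r = node c (graft p l r) (graft q l r)

graft-id : ∀ {L} (p : Tree L) → graft p (leaf true) (leaf false) ≡ p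
graft-id (leaf true)  = ≡.refl
graft-id (leaf false) = ≡.refl
graft-id (node c p q) = ≡.cong₂ (node c) (graft-id p) (graft-id q)

graft-assoc : ∀ {L} (p a b l r : Tree L) →
              graft (graft p a b) l r ≡ graft p (graft a l r) (graft b l r)
graft-assoc (leaf true)  a b l r = ≡.refl
graft-assoc (leaf false) a b l r = ≡.refl
graft-assoc (node c p q) a b l r =
  ≡.cong₂ (node c) (graft-assoc p a b l r) (graft-assoc q a b l r)

mapTree : ∀ {L M} → (L → M) → Tree L → Tree M
mapTree g (leaf b)     = leaf b
mapTree g (node c l r) = node (g c) (mapTree g l) (mapTree g r)

mapTree-graft : ∀ {L M} (g : L → M) (p l r : Tree L) →
                mapTree g (graft p l r) ≡ graft (mapTree g p) (mapTree g l) (mapTree g r)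
mapTree-graft g (leaf true)  l r = ≡.refl
mapTree-graft g (leaf false) l r = ≡.refl
mapTree-graft g (node c p q) l r =
  ≡.cong₂ (node (g c)) (mapTree-graft g p l r) (mapTree-graft g q l r)

JointlyInjective : {I A B : Set} → (I → A → B) → Set
JointlyInjective {A = A} g = ∀ {a b : A} → (∀ i → g i a ≡ g i b) → a ≡ b

mapTree-jointlyInjective : ∀ {I L M} {g : I → L → M} → I → JointlyInjective g →
                           JointlyInjective (λ i → mapTree (g i))
mapTree-jointlyInjective i₀ inj {leaf b} {leaf b′} h with h i₀
... | ≡.refl = ≡.refl
mapTree-jointlyInjective i₀ inj {leaf _} {node _ _ _} h with h i₀
... | ()
mapTree-jointlyInjective i₀ inj {node _ _ _} {leaf _} h with h i₀
... | ()
mapTree-jointlyInjective i₀ inj {node c l r} {node d l′ r′} h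
  with inj (proj₁ ∘ node-injective ∘ h)
     | mapTree-jointlyInjective i₀ inj (proj₁ ∘ proj₂ ∘ node-injective ∘ h)
     | mapTree-jointlyInjective i₀ inj (proj₂ ∘ proj₂ ∘ node-injective ∘ h)
... | ≡.refl | ≡.refl | ≡.refl = ≡.refl

module _ {n : ℕ} {X : Set} where

  toTree : Term n X → Tree (Fin n ⊎ X)
  toTree T           = leaf true
  toTree F           = leaf false
  toTree (atom a)    = node (inj₁ a) (leaf true) (leaf false)
  toTree (var x)     = node (inj₂ x) (leaf true) (leaf false)
  toTree (t ◁ r ▷ s) = graft (toTree r) (toTree t) (toTree s)

  toTree-sound : ∀ {s t : Term n X} → CP⊢ s ≈ t → toTree s ≡ toTree t
  toTree-sound (cp1 x y)       = ≡.refl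
  toTree-sound (cp2 x y)       = ≡.refl
  toTree-sound (cp3 x)         = graft-id (toTree x)
  toTree-sound (cp4 x y z u v) = graft-assoc (toTree z) (toTree y) (toTree u) (toTree x) (toTree v)
  toTree-sound refl            = ≡.refl
  toTree-sound (sym d)         = ≡.sym (toTree-sound d)
  toTree-sound (trans d e)     = ≡.trans (toTree-sound d) (toTree-sound e)
  toTree-sound (cong d e f)
    rewrite toTree-sound d | toTree-sound e | toTree-sound f = ≡.refl

  fromLabel : Fin n ⊎ X → Term n X
  fromLabel = [ atom , var ]′

  fromTree : Tree (Fin n ⊎ X) → Term n X
  fromTree (leaf true)  = T
  fromTree (leaf false) = F
  fromTree (node c l r) = fromTree l ◁ fromLabel c ▷ fromTree r

  fromTree-graft : ∀ (p l r : Tree (Fin n ⊎ X)) →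
                   CP⊢ fromTree l ◁ fromTree p ▷ fromTree r ≈ fromTree (graft p l r)
  fromTree-graft (leaf true)  l r = cp1 _ _
  fromTree-graft (leaf false) l r = cp2 _ _
  fromTree-graft (node c p q) l r =
    trans (cp4 _ _ _ _ _) (cong (fromTree-graft p l r) refl (fromTree-graft q l r))

  fromTree-toTree : ∀ (t : Term n X) → CP⊢ t ≈ fromTree (toTree t)
  fromTree-toTree T           = refl
  fromTree-toTree F           = refl
  fromTree-toTree (atom a)    = sym (cp3 _)
  fromTree-toTree (var x)     = sym (cp3 _)
  fromTree-toTree (t ◁ r ▷ s) =
    trans (cong (fromTree-toTree t) (fromTree-toTree r) (fromTree-toTree s))
          (fromTree-graft (toTree r) (toTree t) (toTree s))

  toTree-complete : ∀ {s t : Term n X} → toTree s ≡ toTree t → CP⊢ s ≈ t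
  toTree-complete {s} {t} e =
    trans (≡.subst (λ p → CP⊢ s ≈ fromTree p) e (fromTree-toTree s)) (sym (fromTree-toTree t))

relabel : ∀ {n} {X Y : Set} → (X → Fin n) → Fin n ⊎ X → Fin n ⊎ Y
relabel ρ (inj₁ a) = inj₁ a
relabel ρ (inj₂ x) = inj₁ (ρ x)

toTree-subst-atoms : ∀ {n} {X Y : Set} (ρ : X → Fin n) (t : Term n X) →
                     toTree {X = Y} (subst (atom ∘ ρ) t) ≡ mapTree (relabel ρ) (toTree t)
toTree-subst-atoms ρ T           = ≡.refl
toTree-subst-atoms ρ F           = ≡.refl
toTree-subst-atoms ρ (atom a)    = ≡.refl
toTree-subst-atoms ρ (var x)     = ≡.refl
toTree-subst-atoms {Y = Y} ρ (t ◁ r ▷ s)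
  rewrite toTree-subst-atoms {Y = Y} ρ t | toTree-subst-atoms {Y = Y} ρ r
        | toTree-subst-atoms {Y = Y} ρ s =
    ≡.sym (mapTree-graft (relabel ρ) (toTree r) (toTree t) (toTree s))

otherAtom : ∀ {m} → Fin (suc (suc m)) → Fin (suc (suc m))
otherAtom zero     = fsuc zero
otherAtom (fsuc _) = zero

otherAtom-≢ : ∀ {m} (a : Fin (suc (suc m))) → a ≢ otherAtom a
otherAtom-≢ zero     ()
otherAtom-≢ (fsuc _) ()

module _ {m : ℕ} {X : Set} (_≟_ : DecidableEquality X) where

  indicator : X → X → Fin (suc (suc m))
  indicator x y = if does (x ≟ y) then zero else fsuc zero

  indicator-self : ∀ x → indicator x x ≡ zero
  indicator-self x with x ≟ x
  ... | yes _  = ≡.refl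
  ... | no x≢x = contradiction ≡.refl x≢x

  indicator-zero : ∀ {x y} → indicator x y ≡ zero → x ≡ y
  indicator-zero {x} {y} e with x ≟ y
  ... | yes x≡y = x≡y
  indicator-zero () | no _

  relabel-jointlyInjective : ∀ {Y : Set} → JointlyInjective (relabel {X = X} {Y})
  relabel-jointlyInjective {a = inj₁ a} {inj₁ b} h = ≡.cong inj₁ (inj₁-injective (h (const zero)))
  relabel-jointlyInjective {a = inj₁ a} {inj₂ y} h =
    contradiction (inj₁-injective (h (const (otherAtom a)))) (otherAtom-≢ a)
  relabel-jointlyInjective {a = inj₂ x} {inj₁ b} h = ≡.sym (relabel-jointlyInjective (≡.sym ∘ h))
  relabel-jointlyInjective {a = inj₂ x} {inj₂ y} h =
    ≡.cong inj₂ (indicator-zero (≡.trans (≡.sym (inj₁-injective (h (indicator x)))) (indicator-self x)))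

mainTheorem1 : (n : ℕ) → n ≥ 2 → (s t : OTerm n) →
               ((σ : ℕ → CTerm n) → CP⊢ subst σ s ≈ subst σ t) →
               CP⊢ s ≈ t
mainTheorem1 (suc (suc m)) (s≤s (s≤s _)) s t H =
  toTree-complete (mapTree-jointlyInjective (const zero) (relabel-jointlyInjective ℕ._≟_) agree)
  where
    open ≡.≡-Reasoning

    agree : ∀ (ρ : ℕ → Fin (suc (suc m))) →
            mapTree (relabel {Y = ⊥} ρ) (toTree s) ≡ mapTree (relabel ρ) (toTree t)
    agree ρ = begin
      mapTree (relabel ρ) (toTree s)  ≡⟨ ≡.sym (toTree-subst-atoms ρ s) ⟩
      toTree (subst (atom ∘ ρ) s)     ≡⟨ toTree-sound (H (atom ∘ ρ)) ⟩
      toTree (subst (atom ∘ ρ) t)     ≡⟨ toTree-subst-atoms ρ t ⟩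
      mapTree (relabel ρ) (toTree t)  ∎
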